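{- Let $G=(V,E)$ be a finite graph of girth $g \geq 12$ and minimum degree $2$, with $n$ vertices and $m$ edges, and let $\gamma(G)$ denote its domination number. Then $$\gamma(G) \geq \max\left\{\sqrt{n},\ \sqrt{\frac{\lfloor g/3 \rfloor-1}{3}\,m}\right\}.$$
   Context: The domination number $\gamma(G)$ is the minimum cardinality of a set $D \subseteq V$ such that every vertex of $V\setminus D$ is adjacent to some vertex of $D$. The girth of a graph is the length of its shortest cycle. -}

module Defs where

open import Data.Nat using (ℕ; zero; suc; _+_; _*_; _≤_; _<_)
open import Data.Fin using (Fin) renaming (_<?_ to _<ᶠ?_)
open import Data.Fin.Subset using (Subset; _∈_; ∣_∣)
open import Data.Bool using (Bool; true; false; if_then_else_; _∧_)
open import Data.List using (List; []; _∷_; _++_; [_]; length; map; allFin)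
open import Data.Nat.ListAction using (sum)
open import Data.List.Relation.Unary.Unique.Propositional using (Unique)
open import Data.Product using (Σ; ∃; _×_; _,_)
open import Data.Sum using (_⊎_)
open import Data.Unit using (⊤)
open import Data.Empty using (⊥)
open import Relation.Nullary.Decidable using (⌊_⌋)
open import Relation.Binary.PropositionalEquality using (_≡_)

record Graph (n : ℕ) : Set where
  field
    adj   : Fin n → Fin n → Bool
    sym   : ∀ u v → adj u v ≡ adj v u
    irrefl : ∀ v → adj v v ≡ false
open Graph public

Adj : ∀ {n} → Graph n → Fin n → Fin n → Set
Adj G u v = adj G u v ≡ true

boolToℕ : Bool → ℕ
boolToℕ true = 1
boolToℕ false = 0

degree : ∀ {n} → Graph n → Fin n → ℕ
degree {n} G v = sum (map (λ w → boolToℕ (adj G v w)) (allFin n))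

edgeCount : ∀ {n} → Graph n → ℕ
edgeCount {n} G =
  sum (map (λ u → sum (map (λ v → boolToℕ (⌊ u <ᶠ? v ⌋ ∧ adj G u v)) (allFin n))) (allFin n))

MinDegree : ∀ {n} → Graph n → ℕ → Set
MinDegree G d = (∀ v → d ≤ degree G v) × ∃ λ v → degree G v ≡ d

Chain : ∀ {n} → Graph n → Fin n → List (Fin n) → Set
Chain G a [] = ⊤
Chain G a (b ∷ bs) = Adj G a b × Chain G b bs

IsCycle : ∀ {n} → Graph n → List (Fin n) → Set
IsCycle G [] = ⊥
IsCycle G (v ∷ vs) = 3 ≤ length (v ∷ vs) × Unique (v ∷ vs) × Chain G v (vs ++ [ v ])

IsGirth : ∀ {n} → Graph n → ℕ → Set
IsGirth G g = (∃ λ c → IsCycle G c × length c ≡ g) × (∀ c → IsCycle G c → g ≤ length c)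

Dominating : ∀ {n} → Graph n → Subset n → Set
Dominating G D = ∀ v → v ∈ D ⊎ (∃ λ w → w ∈ D × Adj G v w)

IsDominationNumber : ∀ {n} → Graph n → ℕ → Set
IsDominationNumber G γ =
  (∃ λ D → Dominating G D × ∣ D ∣ ≡ γ) × (∀ D → Dominating G D → γ ≤ ∣ D ∣)

module Submission where

-- Fix a dominating set D and send each vertex v to a representative F v ∈ D (v itself,
-- or a dominating neighbour).  Large girth makes each class F⁻¹(a) a star around a and
-- joins two classes by at most one edge (unique-cross-edge).  Consequently
--  • a vertex is determined by its class and the class of a neighbour outside it, an
--    injection V → D × D, so n ≤ |D|²;
--  • in the contracted graph H on D (a ~ b when an edge joins the two classes) every
--    cycle has at least g/3 vertices (cycles of H lift to cycles of G at most three
--    times as long) and every vertex has two neighbours, and an ordered edge of G is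
--    determined by one of three labels and an ordered edge of H, so 2m ≤ 3·∑ deg_H.
-- A Moore-type bound for H finishes: around every edge the trees of non-backtracking
-- walks of depth s are disjoint when 2s + 2 ≤ g/3, and summing over the edges together
-- with Cauchy–Schwarz gives (2s + 2)·∑ deg_H ≤ 2|D|²; take 2s + 2 ≥ g/3 − 1.

open import Defs
open import Data.Nat using (ℕ; zero; suc; _+_; _*_; _∸_; _/_; _≤_; _<_; z≤n; s≤s; _≟_)
open import Data.Nat.Properties
open import Data.Nat.Solver using (module +-*-Solver)
open import Data.Nat.DivMod using (m/n*n≤m; /-monoˡ-≤)
open import Data.Nat.ListAction using (sum)
open import Data.Bool using (Bool; true; false; _∧_)
open import Data.Bool.Properties using () renaming (_≟_ to _≟ᵇ_)
open import Data.List using (List; []; _∷_; _++_; [_]; length; map; filter; concatMap; allFin; _ʳ++_)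
open import Data.List.Properties using (length-++; length-map; length-ʳ++; ++-assoc; length-tabulate)
open import Data.List.Membership.Propositional using (find) renaming (_∈_ to _∈ₗ_; _∉_ to _∉ₗ_)
open import Data.List.Membership.Propositional.Properties
  using (∈-∃++; ∈-++⁻; ∈-++⁺ˡ; ∈-++⁺ʳ; ∈-map⁺; ∈-map⁻; ∈-concatMap⁺; ∈-concatMap⁻; ∈-filter⁺; ∈-filter⁻; ∈-allFin)
open import Data.List.Relation.Unary.Any using (here; there)
import Data.List.Relation.Unary.Any as Any
open import Data.List.Relation.Unary.All using (All; []; _∷_)
import Data.List.Relation.Unary.All as All
open import Data.List.Relation.Unary.All.Properties using (¬Any⇒All¬) renaming (++⁺ to All-++⁺)
open import Data.List.Relation.Unary.AllPairs using ([]; _∷_)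
open import Data.List.Relation.Unary.Unique.Propositional using (Unique)
import Data.List.Relation.Unary.Unique.Propositional.Properties as Unique
open import Data.List.Relation.Binary.Disjoint.Propositional using (Disjoint)
open import Data.Fin using (Fin; zero; suc) renaming (_<?_ to _<ᶠ?_)
open import Data.Fin.Properties using (any?) renaming (_≟_ to _≟ᶠ_; <-asym to <ᶠ-asym; <-cmp to <ᶠ-cmp)
open import Data.Fin.Subset using (Subset; _∈_; _∉_; ∣_∣; _-_)
open import Data.Fin.Subset.Properties using (_∈?_; x∈p⇒∣p-x∣<∣p∣; x∈p∧x≢y⇒x∈p-y)
open import Data.Product using (∃; _×_; _,_; proj₁; proj₂)
open import Data.Sum using (_⊎_; inj₁; inj₂; [_,_]′)
open import Data.Unit using (⊤; tt)
open import Data.Empty using (⊥; ⊥-elim)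
open import Relation.Nullary using (¬_; Dec; yes; no; ¬?)
open import Relation.Nullary.Decidable using (_×-dec_; ⌊_⌋)
open import Relation.Binary.Definitions using (tri<; tri≈; tri>)
open import Relation.Binary.PropositionalEquality as ≡
  using (_≡_; _≢_; refl; trans; cong; cong₂; subst; module ≡-Reasoning)
open import Function using (_∘_)

open +-*-Solver

sumOver : ∀ {a} {A : Set a} → (A → ℕ) → List A → ℕ
sumOver f [] = 0
sumOver f (x ∷ xs) = f x + sumOver f xs

module _ {a} {A : Set a} where

  sum-map : ∀ (f : A → ℕ) xs → sum (map f xs) ≡ sumOver f xs
  sum-map f [] = refl
  sum-map f (x ∷ xs) = cong (f x +_) (sum-map f xs)

  sumOver-cong : ∀ {f g : A → ℕ} xs → (∀ {x} → x ∈ₗ xs → f x ≡ g x) → sumOver f xs ≡ sumOver g xs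
  sumOver-cong [] h = refl
  sumOver-cong (x ∷ xs) h = cong₂ _+_ (h (here refl)) (sumOver-cong xs (h ∘ there))

  sumOver-mono : ∀ {f g : A → ℕ} xs → (∀ {x} → x ∈ₗ xs → f x ≤ g x) → sumOver f xs ≤ sumOver g xs
  sumOver-mono [] h = z≤n
  sumOver-mono (x ∷ xs) h = +-mono-≤ (h (here refl)) (sumOver-mono xs (λ m → h (there m)))

  sumOver-const : ∀ c (xs : List A) → sumOver (λ _ → c) xs ≡ length xs * c
  sumOver-const c [] = refl
  sumOver-const c (x ∷ xs) = cong (c +_) (sumOver-const c xs)

  sumOver-+ : ∀ (f g : A → ℕ) xs → sumOver (λ x → f x + g x) xs ≡ sumOver f xs + sumOver g xs
  sumOver-+ f g [] = refl
  sumOver-+ f g (x ∷ xs) rewrite sumOver-+ f g xs =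
    solve 4 (λ a b c d → (a :+ b) :+ (c :+ d) := (a :+ c) :+ (b :+ d)) refl (f x) (g x) (sumOver f xs) (sumOver g xs)

  sumOver-*ˡ : ∀ c (f : A → ℕ) xs → sumOver (λ x → c * f x) xs ≡ c * sumOver f xs
  sumOver-*ˡ c f [] = ≡.sym (*-zeroʳ c)
  sumOver-*ˡ c f (x ∷ xs) rewrite sumOver-*ˡ c f xs = ≡.sym (*-distribˡ-+ c (f x) (sumOver f xs))

  sumOver-*ʳ : ∀ c (f : A → ℕ) xs → sumOver (λ x → f x * c) xs ≡ sumOver f xs * c
  sumOver-*ʳ c f [] = refl
  sumOver-*ʳ c f (x ∷ xs) rewrite sumOver-*ʳ c f xs = ≡.sym (*-distribʳ-+ c (f x) (sumOver f xs))

sumOver-swap : ∀ {a b} {A : Set a} {B : Set b} (f : A → B → ℕ) xs ys →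
               sumOver (λ x → sumOver (f x) ys) xs ≡ sumOver (λ y → sumOver (λ x → f x y) xs) ys
sumOver-swap f [] ys = ≡.sym (trans (sumOver-const 0 ys) (*-zeroʳ (length ys)))
sumOver-swap f (x ∷ xs) ys rewrite sumOver-swap f xs ys = ≡.sym (sumOver-+ (f x) (λ y → sumOver (λ x → f x y) xs) ys)

-- Cauchy–Schwarz for a finite list: (∑ f)² ≤ |xs| · ∑ f², from 2ab ≤ a² + b².

2ab≤a²+b² : ∀ a b → 2 * (a * b) ≤ a * a + b * b
2ab≤a²+b² zero b = z≤n
2ab≤a²+b² (suc a) zero rewrite *-zeroʳ (suc a) = z≤n
2ab≤a²+b² (suc a) (suc b) = begin
  2 * (suc a * suc b)                   ≡⟨ solve 2 (λ a b → con 2 :* ((con 1 :+ a) :* (con 1 :+ b))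
                                             := con 2 :* (a :* b) :+ (con 2 :* a :+ con 2 :* b :+ con 2)) refl a b ⟩
  2 * (a * b) + (2 * a + 2 * b + 2)     ≤⟨ +-monoˡ-≤ (2 * a + 2 * b + 2) (2ab≤a²+b² a b) ⟩
  a * a + b * b + (2 * a + 2 * b + 2)   ≡⟨ solve 2 (λ a b → a :* a :+ b :* b :+ (con 2 :* a :+ con 2 :* b :+ con 2)
                                             := (con 1 :+ a) :* (con 1 :+ a) :+ (con 1 :+ b) :* (con 1 :+ b)) refl a b ⟩
  suc a * suc a + suc b * suc b         ∎
  where open ≤-Reasoning

module _ {a} {A : Set a} (f : A → ℕ) where

  private
    sq : A → ℕ
    sq x = f x * f x

  cross-terms≤ : ∀ x xs → 2 * (f x * sumOver f xs) ≤ length xs * sq x + sumOver sq xs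
  cross-terms≤ x [] rewrite *-zeroʳ (f x) = z≤n
  cross-terms≤ x (y ∷ xs) = begin
    2 * (f x * (f y + sumOver f xs))                           ≡⟨ solve 3 (λ a b c → con 2 :* (a :* (b :+ c))
                                                                   := con 2 :* (a :* b) :+ con 2 :* (a :* c)) refl (f x) (f y) (sumOver f xs) ⟩
    2 * (f x * f y) + 2 * (f x * sumOver f xs)                 ≤⟨ +-mono-≤ (2ab≤a²+b² (f x) (f y)) (cross-terms≤ x xs) ⟩
    (sq x + sq y) + (length xs * sq x + sumOver sq xs)         ≡⟨ solve 4 (λ a b l q → (a :+ b) :+ (l :* a :+ q)
                                                                   := (con 1 :+ l) :* a :+ (b :+ q)) refl (sq x) (sq y) (length xs) (sumOver sq xs) ⟩
    suc (length xs) * sq x + (sq y + sumOver sq xs)            ∎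
    where open ≤-Reasoning

  cauchy-schwarz : ∀ xs → sumOver f xs * sumOver f xs ≤ length xs * sumOver sq xs
  cauchy-schwarz [] = z≤n
  cauchy-schwarz (x ∷ xs) = begin
    (f x + S) * (f x + S)                                  ≡⟨ solve 2 (λ a s → (a :+ s) :* (a :+ s)
                                                               := a :* a :+ (con 2 :* (a :* s) :+ s :* s)) refl (f x) S ⟩
    sq x + (2 * (f x * S) + S * S)                         ≤⟨ +-monoʳ-≤ (sq x) (+-mono-≤ (cross-terms≤ x xs) (cauchy-schwarz xs)) ⟩
    sq x + ((length xs * sq x + Q) + length xs * Q)        ≡⟨ solve 3 (λ a q l → a :+ ((l :* a :+ q) :+ l :* q)
                                                               := (con 1 :+ l) :* (a :+ q)) refl (sq x) Q (length xs) ⟩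
    suc (length xs) * (sq x + Q)                           ∎
    where
    open ≤-Reasoning
    S Q : ℕ
    S = sumOver f xs
    Q = sumOver sq xs

module _ {a} {A : Set a} (p : A → Bool) where

  select : List A → List A
  select = filter (λ x → p x ≟ᵇ true)

  ∈-select⁺ : ∀ {x xs} → x ∈ₗ xs → p x ≡ true → x ∈ₗ select xs
  ∈-select⁺ = ∈-filter⁺ (λ x → p x ≟ᵇ true)

  ∈-select⁻ : ∀ {x xs} → x ∈ₗ select xs → x ∈ₗ xs × p x ≡ true
  ∈-select⁻ = ∈-filter⁻ (λ x → p x ≟ᵇ true)

  select-unique : ∀ {xs} → Unique xs → Unique (select xs)
  select-unique = Unique.filter⁺ (λ x → p x ≟ᵇ true)

  length-select : ∀ xs → length (select xs) ≡ sumOver (boolToℕ ∘ p) xs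
  length-select [] = refl
  length-select (x ∷ xs) with p x
  ... | true = cong suc (length-select xs)
  ... | false = length-select xs

  sumOver-select : ∀ (h : A → ℕ) xs → sumOver h (select xs) ≡ sumOver (λ x → boolToℕ (p x) * h x) xs
  sumOver-select h [] = refl
  sumOver-select h (x ∷ xs) with p x
  ... | true = cong₂ _+_ (≡.sym (+-identityʳ (h x))) (sumOver-select h xs)
  ... | false = sumOver-select h xs

module _ {a} {A : Set a} where

  private
    delete-∈ : ∀ {y x : A} (pre post : List A) → y ∈ₗ (pre ++ x ∷ post) → y ≢ x → y ∈ₗ (pre ++ post)
    delete-∈ [] post (here e) ne = ⊥-elim (ne e)
    delete-∈ [] post (there m) ne = m
    delete-∈ (p ∷ pre) post (here e) ne = here e
    delete-∈ (p ∷ pre) post (there m) ne = there (delete-∈ pre post m ne)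

  unique-⊆-length≤ : ∀ {xs ys : List A} → Unique xs → (∀ {x} → x ∈ₗ xs → x ∈ₗ ys) → length xs ≤ length ys
  unique-⊆-length≤ {[]} _ _ = z≤n
  unique-⊆-length≤ {x ∷ xs} {ys} (x∉xs ∷ xs!) xs⊆ys with ∈-∃++ (xs⊆ys (here refl))
  ... | pre , post , refl = begin
    suc (length xs)                ≤⟨ s≤s (unique-⊆-length≤ xs! (λ m → delete-∈ pre post (xs⊆ys (there m)) (≢x m))) ⟩
    suc (length (pre ++ post))     ≡⟨ cong suc (length-++ pre) ⟩
    suc (length pre + length post) ≡⟨ ≡.sym (+-suc (length pre) (length post)) ⟩
    length pre + suc (length post) ≡⟨ ≡.sym (length-++ pre) ⟩
    length (pre ++ x ∷ post)       ∎
    where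
    open ≤-Reasoning
    ≢x : ∀ {y} → y ∈ₗ xs → y ≢ x
    ≢x m refl = Unique.Unique[x∷xs]⇒x∉xs (x∉xs ∷ xs!) m

module _ {a b} {A : Set a} {B : Set b} where

  injection-length≤ : ∀ (f : A → B) {xs : List A} {ys : List B} → Unique xs →
                      (∀ {x y} → x ∈ₗ xs → y ∈ₗ xs → f x ≡ f y → x ≡ y) →
                      (∀ {x} → x ∈ₗ xs → f x ∈ₗ ys) → length xs ≤ length ys
  injection-length≤ f {xs} {ys} xs! inj into = begin
    length xs          ≡⟨ ≡.sym (length-map f xs) ⟩
    length (map f xs)  ≤⟨ unique-⊆-length≤ (map-unique xs! inj) image⊆ ⟩
    length ys          ∎
    where
    open ≤-Reasoning
    map-unique : ∀ {zs} → Unique zs → (∀ {x y} → x ∈ₗ zs → y ∈ₗ zs → f x ≡ f y → x ≡ y) → Unique (map f zs)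
    map-unique [] _ = []
    map-unique {z ∷ zs} (z∉ ∷ zs!) inj′ =
      All.tabulate (λ m eq → let y , my , fy = ∈-map⁻ f m in
        Unique.Unique[x∷xs]⇒x∉xs (z∉ ∷ zs!) (subst (_∈ₗ zs) (≡.sym (inj′ (here refl) (there my) (trans eq fy))) my))
      ∷ map-unique zs! (λ m₁ m₂ → inj′ (there m₁) (there m₂))
    image⊆ : ∀ {z} → z ∈ₗ map f xs → z ∈ₗ ys
    image⊆ m with ∈-map⁻ f m
    ... | x , mx , refl = into mx

unique-⊆-subset : ∀ {n} (xs : List (Fin n)) (D : Subset n) → Unique xs → All (_∈ D) xs → length xs ≤ ∣ D ∣
unique-⊆-subset [] D _ _ = z≤n
unique-⊆-subset (x ∷ xs) D (x∉xs ∷ xs!) (x∈D ∷ xs⊆D) =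
  ≤-trans (s≤s (unique-⊆-subset xs (D - x) xs! (All.zipWith (λ (ne , m) → x∈p∧x≢y⇒x∈p-y m (ne ∘ ≡.sym)) (x∉xs , xs⊆D))))
          (x∈p⇒∣p-x∣<∣p∣ x∈D)

module _ {a b} {A : Set a} {B : Set b} (f : A → List B) where

  ∈-concatMap-witness : ∀ {y ws} → y ∈ₗ concatMap f ws → ∃ λ w → w ∈ₗ ws × y ∈ₗ f w
  ∈-concatMap-witness m = find (∈-concatMap⁻ f m)

  length-concatMap : ∀ ws → length (concatMap f ws) ≡ sumOver (length ∘ f) ws
  length-concatMap [] = refl
  length-concatMap (w ∷ ws) = trans (length-++ (f w)) (cong (length (f w) +_) (length-concatMap ws))

  concatMap-unique : ∀ {ws} → Unique ws → (∀ {w} → w ∈ₗ ws → Unique (f w)) →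
                     (∀ {w₁ w₂} → w₁ ∈ₗ ws → w₂ ∈ₗ ws → w₁ ≢ w₂ → Disjoint (f w₁) (f w₂)) →
                     Unique (concatMap f ws)
  concatMap-unique {[]} _ _ _ = []
  concatMap-unique {w ∷ ws} (w∉ ∷ ws!) pieces! apart =
    Unique.++⁺ (pieces! (here refl)) (concatMap-unique ws! (pieces! ∘ there) (λ m₁ m₂ → apart (there m₁) (there m₂))) head-apart
    where
    head-apart : Disjoint (f w) (concatMap f ws)
    head-apart (m₁ , m₂) with ∈-concatMap-witness m₂
    ... | w′ , mw′ , m′ = apart (here refl) (there mw′) (λ { refl → Unique.Unique[x∷xs]⇒x∉xs (w∉ ∷ ws!) mw′ }) (m₁ , m′)

module _ {a b} {A : Set a} {B : Set b} where

  pairs : (A → List B) → List A → List (A × B)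
  pairs ys = concatMap (λ x → map (x ,_) (ys x))

  length-pairs : ∀ (ys : A → List B) xs → length (pairs ys xs) ≡ sumOver (length ∘ ys) xs
  length-pairs ys xs = trans (length-concatMap _ xs) (sumOver-cong xs (λ {x} _ → length-map (x ,_) (ys x)))

  ∈-pairs⁺ : ∀ (ys : A → List B) {x y xs} → x ∈ₗ xs → y ∈ₗ ys x → (x , y) ∈ₗ pairs ys xs
  ∈-pairs⁺ ys mx my = ∈-concatMap⁺ _ (Any.map (λ { refl → ∈-map⁺ _ my }) mx)

  ∈-pairs⁻ : ∀ (ys : A → List B) {x y xs} → (x , y) ∈ₗ pairs ys xs → x ∈ₗ xs × y ∈ₗ ys x
  ∈-pairs⁻ ys m with ∈-concatMap-witness _ m
  ... | w , mw , m′ with ∈-map⁻ (w ,_) m′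
  ...   | _ , my , refl = mw , my

  pairs-unique : ∀ (ys : A → List B) {xs} → Unique xs → (∀ x → Unique (ys x)) → Unique (pairs ys xs)
  pairs-unique ys xs! ys! = concatMap-unique _ xs! (λ {x} _ → Unique.map⁺ (cong proj₂) (ys! x)) apart
    where
    apart : ∀ {x₁ x₂} → _ → _ → x₁ ≢ x₂ → Disjoint (map (x₁ ,_) (ys x₁)) (map (x₂ ,_) (ys x₂))
    apart _ _ x₁≢x₂ (m₁ , m₂) with ∈-map⁻ _ m₁ | ∈-map⁻ _ m₂
    ... | _ , _ , refl | _ , _ , eq = x₁≢x₂ (cong proj₁ eq)

module _ {a} {A : Set a} where

  unique-++ˡ : ∀ (xs : List A) {ys} → Unique (xs ++ ys) → Unique xs
  unique-++ˡ [] _ = []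
  unique-++ˡ (x ∷ xs) (x∉ ∷ u) = All.tabulate (λ m → All.lookup x∉ (∈-++⁺ˡ m)) ∷ unique-++ˡ xs u

  unique-++-∉ : ∀ (xs : List A) {x ys} → Unique (xs ++ x ∷ ys) → x ∉ₗ xs
  unique-++-∉ (y ∷ xs) (y∉ ∷ _) (here refl) = All.lookup y∉ (∈-++⁺ʳ xs (here refl)) refl
  unique-++-∉ (y ∷ xs) (_ ∷ u) (there m) = unique-++-∉ xs u m

  private
    ʳ++-suffix-unique : ∀ (xs : List A) {ys} → Unique (xs ʳ++ ys) → Unique ys
    ʳ++-suffix-unique [] u = u
    ʳ++-suffix-unique (x ∷ xs) u with ʳ++-suffix-unique xs u
    ... | _ ∷ u′ = u′

  unique-ʳ++-disjoint : ∀ (xs : List A) {ys} → Unique (xs ʳ++ ys) → Disjoint xs ys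
  unique-ʳ++-disjoint (x ∷ xs) u (here refl , m) = Unique.Unique[x∷xs]⇒x∉xs (ʳ++-suffix-unique xs u) m
  unique-ʳ++-disjoint (x ∷ xs) u (there m₁ , m₂) = unique-ʳ++-disjoint xs u (m₁ , there m₂)

-- Walks in a graph.  A walk is given by its first vertex a and the list xs of the
-- following vertices (the notion Chain); endpoint a xs is its last vertex.
module Walks {n} (G : Graph n) where

  adj-sym : ∀ {x y} → Adj G x y → Adj G y x
  adj-sym {x} {y} e = trans (Graph.sym G y x) e

  adj-irrefl : ∀ {x} → ¬ Adj G x x
  adj-irrefl {x} e with trans (≡.sym e) (Graph.irrefl G x)
  ... | ()

  adj-≢ : ∀ {x y} → Adj G x y → x ≢ y
  adj-≢ e refl = adj-irrefl e

  endpoint : Fin n → List (Fin n) → Fin n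
  endpoint a [] = a
  endpoint a (x ∷ xs) = endpoint x xs

  endpoint-++ : ∀ a xs {y ys} → endpoint a (xs ++ y ∷ ys) ≡ endpoint y ys
  endpoint-++ a [] = refl
  endpoint-++ a (x ∷ xs) = endpoint-++ x xs

  chain-++ : ∀ a xs {y ys} → Chain G a xs → Adj G (endpoint a xs) y → Chain G y ys → Chain G a (xs ++ y ∷ ys)
  chain-++ a [] c e c′ = e , c′
  chain-++ a (x ∷ xs) (e₀ , c) e c′ = e₀ , chain-++ x xs c e c′

  chain-++⁻ : ∀ a xs {y ys} → Chain G a (xs ++ y ∷ ys) → Chain G a xs × Adj G (endpoint a xs) y × Chain G y ys
  chain-++⁻ a [] (e , c) = tt , e , c
  chain-++⁻ a (x ∷ xs) (e₀ , c) = let c₁ , e , c₂ = chain-++⁻ x xs c in (e₀ , c₁) , e , c₂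

  NonBacktracking : List (Fin n) → Set
  NonBacktracking (x ∷ y ∷ z ∷ r) = Adj G x y × x ≢ z × NonBacktracking (y ∷ z ∷ r)
  NonBacktracking (x ∷ y ∷ []) = Adj G x y
  NonBacktracking _ = ⊤

  nb-tail : ∀ {x} xs → NonBacktracking (x ∷ xs) → NonBacktracking xs
  nb-tail [] _ = tt
  nb-tail (y ∷ []) _ = tt
  nb-tail (y ∷ z ∷ r) (_ , _ , nb) = nb

  nb-chain : ∀ x xs → NonBacktracking (x ∷ xs) → Chain G x xs
  nb-chain x [] _ = tt
  nb-chain x (y ∷ []) e = e , tt
  nb-chain x (y ∷ z ∷ r) (e , _ , nb) = e , nb-chain y (z ∷ r) nb

  _≢head_ : Fin n → List (Fin n) → Set
  x ≢head [] = ⊤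
  x ≢head (y ∷ _) = x ≢ y

  -- Walks xs = x ∷ … and ys = a ∷ … are joinable when the walk "xs reversed, then ys"
  -- (… → x → a → …) uses the edge x ~ a without backtracking at either end of it.
  Joinable : List (Fin n) → List (Fin n) → Set
  Joinable (x ∷ xs) (a ∷ as) = Adj G x a × a ≢head xs × x ≢head as
  Joinable _ _ = ⊤

  nb-ʳ++ : ∀ xs ys → NonBacktracking xs → NonBacktracking ys → Joinable xs ys → NonBacktracking (xs ʳ++ ys)
  nb-ʳ++ [] ys _ nb _ = nb
  nb-ʳ++ (x ∷ xs) ys nbx nby j = nb-ʳ++ xs (x ∷ ys) (nb-tail xs nbx) (cons ys nby j) (joinable xs ys nbx j)
    where
    cons : ∀ ys → NonBacktracking ys → Joinable (x ∷ xs) ys → NonBacktracking (x ∷ ys)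
    cons [] _ _ = tt
    cons (a ∷ []) _ (e , _) = e
    cons (a ∷ b ∷ r) nb (e , _ , x≢b) = e , x≢b , nb
    joinable : ∀ xs ys → NonBacktracking (x ∷ xs) → Joinable (x ∷ xs) ys → Joinable xs (x ∷ ys)
    joinable [] _ _ _ = tt
    joinable (y ∷ []) [] e _ = adj-sym e , tt , tt
    joinable (y ∷ []) (a ∷ _) e (_ , a≢y , _) = adj-sym e , tt , a≢y ∘ ≡.sym
    joinable (y ∷ z ∷ _) [] (e , x≢z , _) _ = adj-sym e , x≢z , tt
    joinable (y ∷ z ∷ _) (a ∷ _) (e , x≢z , _) (_ , a≢y , _) = adj-sym e , x≢z , a≢y ∘ ≡.sym

  -- In a graph all of whose cycles have at least t vertices, short non-backtracking
  -- walks do not revisit a vertex: a revisit would close a cycle on fewer than t vertices.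
  module LargeGirth (t : ℕ) (girth≥t : ∀ c → IsCycle G c → t ≤ length c) where
    open import Data.List.Membership.DecPropositional (_≟ᶠ_ {n}) using () renaming (_∈?_ to _∈ₗ?_)

    short-nb-unique : ∀ W → NonBacktracking W → length W ≤ t → Unique W
    short-nb-unique [] _ _ = []
    short-nb-unique (x ∷ W) nb W≤t with short-nb-unique W (nb-tail W nb) (≤-trans (n≤1+n _) W≤t) | x ∈ₗ? W
    ... | W! | no x∉W = ¬Any⇒All¬ W x∉W ∷ W!
    ... | W! | yes x∈W with ∈-∃++ x∈W
    ...   | pre , post , refl = ⊥-elim (<⇒≱ short (girth≥t (x ∷ pre) cycle))
      where
      closing : Chain G x (pre ++ [ x ])
      closing = let c , e , _ = chain-++⁻ x pre (nb-chain x (pre ++ x ∷ post) nb) in chain-++ x pre c e tt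
      three≤ : ∀ pre post → NonBacktracking (x ∷ pre ++ x ∷ post) → 3 ≤ length (x ∷ pre)
      three≤ [] [] x~x = ⊥-elim (adj-irrefl x~x)
      three≤ [] (_ ∷ _) (x~x , _) = ⊥-elim (adj-irrefl x~x)
      three≤ (y ∷ []) _ (_ , x≢x , _) = ⊥-elim (x≢x refl)
      three≤ (y ∷ z ∷ _) _ _ = s≤s (s≤s (s≤s z≤n))
      cycle : IsCycle G (x ∷ pre)
      cycle = three≤ pre post nb , (¬Any⇒All¬ pre (unique-++-∉ pre W!) ∷ unique-++ˡ pre W!) , closing
      short : length (x ∷ pre) < t
      short = begin-strict
        suc (length pre)                      <⟨ s≤s (s≤s (m≤m+n (length pre) (length post))) ⟩
        suc (suc (length pre + length post))  ≡⟨ cong suc (≡.sym (+-suc (length pre) (length post))) ⟩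
        suc (length pre + suc (length post))  ≡⟨ cong suc (≡.sym (length-++ pre)) ⟩
        length (x ∷ pre ++ x ∷ post)          ≤⟨ W≤t ⟩
        t                                     ∎
        where open ≤-Reasoning

    joined-disjoint : ∀ xs ys → NonBacktracking xs → NonBacktracking ys → Joinable xs ys →
                      length xs + length ys ≤ t → Disjoint xs ys
    joined-disjoint xs ys nbx nby j len =
      unique-ʳ++-disjoint xs (short-nb-unique (xs ʳ++ ys) (nb-ʳ++ xs ys nbx nby j) (≤-trans (≤-reflexive (length-ʳ++ xs)) len))

  neighbours : Fin n → List (Fin n)
  neighbours v = select (adj G v) (allFin n)

  degree≡length : ∀ v → degree G v ≡ length (neighbours v)
  degree≡length v = trans (sum-map _ (allFin n)) (≡.sym (length-select (adj G v) (allFin n)))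

  another-neighbour : ∀ {v} → 2 ≤ degree G v → ∀ x → ∃ λ w → Adj G v w × w ≢ x
  another-neighbour {v} deg≥2 x with any? (λ w → (adj G v w ≟ᵇ true) ×-dec ¬? (w ≟ᶠ x))
  ... | yes found = found
  ... | no none = ⊥-elim (<⇒≱ (s≤s (s≤s z≤n)) (≤-trans deg≥2 (≤-trans (≤-reflexive (degree≡length v))
                    (unique-⊆-length≤ (select-unique (adj G v) (Unique.allFin⁺ n)) only-x))))
    where
    only-x : ∀ {w} → w ∈ₗ neighbours v → w ∈ₗ [ x ]
    only-x {w} m with w ≟ᶠ x
    ... | yes w≡x = here w≡x
    ... | no w≢x = ⊥-elim (none (w , proj₂ (∈-select⁻ (adj G v) {xs = allFin n} m) , w≢x))

  private
    ordered : Fin n → Fin n → ℕ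
    ordered u v = boolToℕ (⌊ u <ᶠ? v ⌋ ∧ adj G u v)

    split-adjacency : ∀ u v → boolToℕ (adj G u v) ≡ ordered u v + ordered v u
    split-adjacency u v with u <ᶠ? v | v <ᶠ? u
    ... | yes u<v | yes v<u = ⊥-elim (<ᶠ-asym u<v v<u)
    ... | yes _ | no _ = ≡.sym (+-identityʳ _)
    ... | no _ | yes _ = cong boolToℕ (Graph.sym G u v)
    ... | no u≮v | no v≮u with <ᶠ-cmp u v
    ...   | tri< u<v _ _ = ⊥-elim (u≮v u<v)
    ...   | tri> _ _ v<u = ⊥-elim (v≮u v<u)
    ...   | tri≈ _ refl _ rewrite Graph.irrefl G u = refl

    edgeCount≡ : edgeCount G ≡ sumOver (λ u → sumOver (ordered u) (allFin n)) (allFin n)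
    edgeCount≡ = trans (sum-map _ (allFin n)) (sumOver-cong (allFin n) (λ {u} _ → sum-map (ordered u) (allFin n)))

  handshake : length (pairs neighbours (allFin n)) ≡ 2 * edgeCount G
  handshake = begin
    length (pairs neighbours Vs)                                              ≡⟨ length-pairs neighbours Vs ⟩
    sumOver (length ∘ neighbours) Vs                                          ≡⟨ sumOver-cong Vs (λ {u} _ → length-select (adj G u) Vs) ⟩
    sumOver (λ u → sumOver (boolToℕ ∘ adj G u) Vs) Vs                         ≡⟨ sumOver-cong Vs (λ {u} _ → sumOver-cong Vs (λ {v} _ → split-adjacency u v)) ⟩
    sumOver (λ u → sumOver (λ v → ordered u v + ordered v u) Vs) Vs           ≡⟨ sumOver-cong Vs (λ {u} _ → sumOver-+ (ordered u) (λ v → ordered v u) Vs) ⟩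
    sumOver (λ u → sumOver (ordered u) Vs + sumOver (λ v → ordered v u) Vs) Vs
                                                                              ≡⟨ sumOver-+ _ _ Vs ⟩
    E + sumOver (λ u → sumOver (λ v → ordered v u) Vs) Vs                     ≡⟨ cong (E +_) (sumOver-swap (λ u v → ordered v u) Vs Vs) ⟩
    E + E                                                                     ≡⟨ cong (E +_) (≡.sym (+-identityʳ E)) ⟩
    2 * E                                                                     ≡⟨ cong (2 *_) (≡.sym edgeCount≡) ⟩
    2 * edgeCount G                                                           ∎
    where
    open ≡-Reasoning
    Vs : List (Fin n)
    Vs = allFin n
    E : ℕ
    E = sumOver (λ u → sumOver (ordered u) Vs) Vs

-- The arithmetic behind the Moore-type bound: from  2sQ + 2A ≤ A(k + 2s)  (edge trees),
-- A² ≤ kQ  (Cauchy–Schwarz) and  k ≥ 2s + 2  it follows that  (2s + 2)A ≤ 2k².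

cancel-degree-sum : ∀ s A Q k → 1 ≤ A → 2 * s * Q + 2 * A ≤ A * (k + 2 * s) → A * A ≤ k * Q →
                    2 * s * A + 2 * k ≤ k * (k + 2 * s)
cancel-degree-sum s A@(suc _) Q k _ trees cs = *-cancelˡ-≤ A (begin
  A * (2 * s * A + 2 * k)          ≡⟨ solve 3 (λ a s k → a :* (con 2 :* s :* a :+ con 2 :* k)
                                         := con 2 :* s :* (a :* a) :+ con 2 :* k :* a) refl A s k ⟩
  2 * s * (A * A) + 2 * k * A      ≤⟨ +-monoˡ-≤ (2 * k * A) (*-monoʳ-≤ (2 * s) cs) ⟩
  2 * s * (k * Q) + 2 * k * A      ≡⟨ solve 4 (λ a s k q → con 2 :* s :* (k :* q) :+ con 2 :* k :* a
                                         := k :* (con 2 :* s :* q :+ con 2 :* a)) refl A s k Q ⟩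
  k * (2 * s * Q + 2 * A)          ≤⟨ *-monoʳ-≤ k trees ⟩
  k * (A * (k + 2 * s))            ≡⟨ solve 3 (λ a s k → k :* (a :* (k :+ con 2 :* s))
                                         := a :* (k :* (k :+ con 2 :* s))) refl A s k ⟩
  A * (k * (k + 2 * s))            ∎)
  where open ≤-Reasoning

moore-arithmetic : ∀ s′ A k → let s = suc s′ in 2 * s + 2 ≤ k → 2 * s * A + 2 * k ≤ k * (k + 2 * s) →
                   (2 * s + 2) * A ≤ 2 * (k * k)
moore-arithmetic s′ A k k≥ ineq with m≤n⇒∃[o]m+o≡n k≥
... | d , refl = *-cancelˡ-≤ (2 * s) (+-cancelʳ-≤ (c * (2 * k)) _ _ (begin
  2 * s * (c * A) + c * (2 * k)      ≡⟨ solve 4 (λ s a c k → con 2 :* s :* (c :* a) :+ c :* (con 2 :* k)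
                                           := c :* (con 2 :* s :* a :+ con 2 :* k)) refl s A c k ⟩
  c * (2 * s * A + 2 * k)            ≤⟨ *-monoʳ-≤ c ineq ⟩
  c * (k * (k + 2 * s))              ≤⟨ m≤m+n _ (2 * s′ * d * k) ⟩
  c * (k * (k + 2 * s)) + 2 * s′ * d * k
                                     ≡⟨ solve 2 (λ s′ d → (con 2 :* (con 1 :+ s′) :+ con 2) :* ((con 2 :* (con 1 :+ s′) :+ con 2 :+ d)
                                               :* ((con 2 :* (con 1 :+ s′) :+ con 2 :+ d) :+ con 2 :* (con 1 :+ s′)))
                                             :+ con 2 :* s′ :* d :* (con 2 :* (con 1 :+ s′) :+ con 2 :+ d)
                                           := con 2 :* (con 1 :+ s′) :* (con 2 :* ((con 2 :* (con 1 :+ s′) :+ con 2 :+ d)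
                                               :* (con 2 :* (con 1 :+ s′) :+ con 2 :+ d)))
                                             :+ (con 2 :* (con 1 :+ s′) :+ con 2) :* (con 2 :* (con 2 :* (con 1 :+ s′) :+ con 2 :+ d))) refl s′ d ⟩
  2 * s * (2 * (k * k)) + c * (2 * k) ∎))
  where
  open ≤-Reasoning
  s c : ℕ
  s = suc s′
  c = 2 * s + 2

-- H is a graph all of whose cycles
-- have at least t vertices; its non-isolated vertices lie in the duplicate-free list
-- Dl of length k, and every step p → c of H can be continued to some c → b with b ≠ p
-- (minimum degree 2 on non-isolated vertices).  The proof grows, around every edge uv, the two trees of
-- non-backtracking walks of length s leaving u and v; large girth makes them disjoint,
-- so they fit into Dl.  Summing over all edges and applying Cauchy–Schwarz gives the bound.
module MooreBound {n} (H : Graph n) (t : ℕ) (girth≥t : ∀ c → IsCycle H c → t ≤ length c)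
                  (Dl : List (Fin n)) (Dl! : Unique Dl) (covered : ∀ {a b} → Adj H a b → a ∈ₗ Dl)
                  (branching : ∀ {p c} → Adj H p c → ∃ λ b → Adj H c b × b ≢ p) where

  open Walks H
  open LargeGirth t girth≥t

  k : ℕ
  k = length Dl

  nbrs : Fin n → List (Fin n)
  nbrs a = select (adj H a) Dl

  deg : Fin n → ℕ
  deg a = length (nbrs a)

  ∈-nbrs⁺ : ∀ {a b} → Adj H a b → b ∈ₗ nbrs a
  ∈-nbrs⁺ {a} e = ∈-select⁺ (adj H a) (covered (adj-sym e)) e

  ∈-nbrs⁻ : ∀ {a b} → b ∈ₗ nbrs a → Adj H a b
  ∈-nbrs⁻ {a} m = proj₂ (∈-select⁻ (adj H a) {xs = Dl} m)

  private
    Continuation : Fin n → Fin n → Set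
    Continuation p c = ∃ λ b → Adj H c b × b ≢ p

    continuation? : ∀ p c → Dec (Continuation p c)
    continuation? p c = any? (λ b → (adj H c b ≟ᵇ true) ×-dec ¬? (b ≟ᶠ p))

    pick : ∀ {p c} → Dec (Continuation p c) → Fin n
    pick (yes (b , _)) = b
    pick {p} (no _) = p

  next : Fin n → Fin n → Fin n
  next p c = pick (continuation? p c)

  next-step : ∀ {p c} → Adj H p c → Adj H c (next p c) × next p c ≢ p
  next-step {p} {c} e with continuation? p c
  ... | yes (_ , e′ , b≢p) = e′ , b≢p
  ... | no none = ⊥-elim (none (branching e))

  ray : ℕ → Fin n → Fin n → List (Fin n)
  ray zero p c = []
  ray (suc m) p c = c ∷ ray m c (next p c)

  length-ray : ∀ m p c → length (ray m p c) ≡ m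
  length-ray zero p c = refl
  length-ray (suc m) p c = cong suc (length-ray m c (next p c))

  ray-nb : ∀ m {p c} → Adj H p c → NonBacktracking (p ∷ ray m p c)
  ray-nb zero e = tt
  ray-nb (suc zero) e = e
  ray-nb (suc (suc m)) e = e , proj₂ (next-step e) ∘ ≡.sym , ray-nb (suc m) (proj₁ (next-step e))

  ray-away : ∀ m {p c} → Adj H p c → p ≢head ray m c (next p c)
  ray-away zero e = tt
  ray-away (suc m) e = proj₂ (next-step e) ∘ ≡.sym

  ray-⊆ : ∀ m {p c} → Adj H p c → All (_∈ₗ Dl) (ray m p c)
  ray-⊆ zero e = []
  ray-⊆ (suc m) e = covered (adj-sym e) ∷ ray-⊆ m (proj₁ (next-step e))

  -- The trees of depth s = suc s′ around an edge; they fit as long as 2s + 2 ≤ t.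
  module EdgeTrees (s′ : ℕ) (room : 2 * suc s′ + 2 ≤ t) where

    s : ℕ
    s = suc s′

    others : Fin n → Fin n → List (Fin n)
    others u v = filter (λ w → ¬? (w ≟ᶠ v)) (nbrs u)

    ∈-others⁻ : ∀ {u v w} → w ∈ₗ others u v → Adj H u w × w ≢ v
    ∈-others⁻ {u} m = let m′ , w≢v = ∈-filter⁻ (λ w → ¬? (w ≟ᶠ _)) {xs = nbrs u} m in ∈-nbrs⁻ m′ , w≢v

    branches : Fin n → Fin n → List (Fin n)
    branches u v = concatMap (ray s u) (others u v)

    record Reach (u v z : Fin n) : Set where
      field
        rest  : List (Fin n)
        walk  : NonBacktracking (u ∷ rest)
        on    : z ∈ₗ u ∷ rest
        short : length rest ≤ s
        away  : v ≢head rest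

    reach : ∀ {u v z} → z ∈ₗ u ∷ branches u v → Reach u v z
    reach (here refl) = record { rest = [] ; walk = tt ; on = here refl ; short = z≤n ; away = tt }
    reach {u} (there m) with ∈-concatMap-witness (ray s u) m
    ... | w , mw , mz = record
      { rest = ray s u w ; walk = ray-nb s (proj₁ (∈-others⁻ mw)) ; on = there mz
      ; short = ≤-reflexive (length-ray s u w) ; away = proj₂ (∈-others⁻ mw) ∘ ≡.sym }

    within-girth : ∀ {a b} → a ≤ suc s → b ≤ suc s → a + b ≤ t
    within-girth a≤ b≤ = ≤-trans (+-mono-≤ a≤ b≤)
      (≤-trans (≤-reflexive (solve 1 (λ s → (con 1 :+ s) :+ (con 1 :+ s) := con 2 :* s :+ con 2) refl s)) room)

    ray-unique : ∀ {u w} → Adj H u w → Unique (u ∷ ray s u w)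
    ray-unique {u} {w} e = short-nb-unique (u ∷ ray s u w) (ray-nb s e)
      (≤-trans (≤-reflexive (≡.sym (+-identityʳ _))) (within-girth (≤-reflexive (cong suc (length-ray s u w))) z≤n))

    -- Large girth separates: distinct rays at u, and the two sides of an edge, are disjoint.
    rays-disjoint : ∀ {u w₁ w₂} → Adj H u w₁ → Adj H u w₂ → w₁ ≢ w₂ → Disjoint (ray s u w₁) (ray s u w₂)
    rays-disjoint {u} {w₁} {w₂} e₁ e₂ w₁≢w₂ (m₁ , m₂) =
      joined-disjoint (u ∷ ray s u w₁) (ray s u w₂) (ray-nb s e₁) (nb-tail (ray s u w₂) (ray-nb s e₂))
        (e₂ , w₁≢w₂ ∘ ≡.sym , ray-away s′ e₂)
        (within-girth (≤-reflexive (cong suc (length-ray s u w₁))) (≤-trans (≤-reflexive (length-ray s u w₂)) (n≤1+n s)))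
        (there m₁ , m₂)

    sides-disjoint : ∀ {u v} → Adj H u v → Disjoint (u ∷ branches u v) (v ∷ branches v u)
    sides-disjoint {u} {v} e (m₁ , m₂) =
      joined-disjoint (u ∷ R₁.rest) (v ∷ R₂.rest) R₁.walk R₂.walk (e , R₁.away , R₂.away)
        (within-girth (s≤s R₁.short) (s≤s R₂.short)) (R₁.on , R₂.on)
      where
      module R₁ = Reach (reach m₁)
      module R₂ = Reach (reach m₂)

    side-unique : ∀ {u v} → Adj H u v → Unique (u ∷ branches u v)
    side-unique {u} {v} e =
      All.tabulate u∉ ∷ concatMap-unique (ray s u) others! (λ m → tail! (ray-unique (proj₁ (∈-others⁻ m))))
                          (λ m₁ m₂ → rays-disjoint (proj₁ (∈-others⁻ m₁)) (proj₁ (∈-others⁻ m₂)))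
      where
      tail! : ∀ {x xs} → Unique (x ∷ xs) → Unique xs
      tail! (_ ∷ xs!) = xs!
      others! : Unique (others u v)
      others! = Unique.filter⁺ (λ w → ¬? (w ≟ᶠ v)) (select-unique (adj H u) Dl!)
      u∉ : ∀ {z} → z ∈ₗ branches u v → u ≢ z
      u∉ m refl with ∈-concatMap-witness (ray s u) m
      ... | w , mw , mz = Unique.Unique[x∷xs]⇒x∉xs (ray-unique (proj₁ (∈-others⁻ mw))) mz

    side-⊆ : ∀ {u v} → Adj H u v → All (_∈ₗ Dl) (u ∷ branches u v)
    side-⊆ {u} e = covered e ∷ All.tabulate (λ m → let w , mw , mz = ∈-concatMap-witness (ray s u) m in
                                                All.lookup (ray-⊆ s (proj₁ (∈-others⁻ mw))) mz)

    length-side : ∀ u v → length (u ∷ branches u v) ≡ suc (length (others u v) * s)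
    length-side u v = cong suc (trans (length-concatMap (ray s u) (others u v))
                        (trans (sumOver-cong (others u v) (λ {w} _ → length-ray s u w)) (sumOver-const s (others u v))))

    deg≤ : ∀ {u v} → Adj H u v → deg u ≤ suc (length (others u v))
    deg≤ {u} {v} e = unique-⊆-length≤ (select-unique (adj H u) Dl!) split
      where
      split : ∀ {w} → w ∈ₗ nbrs u → w ∈ₗ v ∷ others u v
      split {w} m with w ≟ᶠ v
      ... | yes refl = here refl
      ... | no w≢v = there (∈-filter⁺ (λ w → ¬? (w ≟ᶠ v)) m w≢v)

    others-nonempty : ∀ {u v} → Adj H u v → 1 ≤ length (others u v)
    others-nonempty {u} {v} e with branching (adj-sym e)
    ... | w , u~w , w≢v = nonempty (∈-filter⁺ (λ w → ¬? (w ≟ᶠ v)) (∈-nbrs⁺ u~w) w≢v)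
      where
      nonempty : ∀ {xs : List (Fin n)} {x} → x ∈ₗ xs → 1 ≤ length xs
      nonempty (here _) = s≤s z≤n
      nonempty (there _) = s≤s z≤n

    trees-fit : ∀ {u v} → Adj H u v → suc (length (others u v) * s) + suc (length (others v u) * s) ≤ k
    trees-fit {u} {v} e = begin
      suc (length (others u v) * s) + suc (length (others v u) * s)
        ≡⟨ ≡.sym (cong₂ _+_ (length-side u v) (length-side v u)) ⟩
      length (u ∷ branches u v) + length (v ∷ branches v u)
        ≡⟨ ≡.sym (length-++ (u ∷ branches u v)) ⟩
      length ((u ∷ branches u v) ++ (v ∷ branches v u))
        ≤⟨ unique-⊆-length≤ (Unique.++⁺ (side-unique e) (side-unique (adj-sym e)) (sides-disjoint e)) ⊆Dl ⟩
      k ∎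
      where
      open ≤-Reasoning
      ⊆Dl : ∀ {z} → z ∈ₗ (u ∷ branches u v) ++ (v ∷ branches v u) → z ∈ₗ Dl
      ⊆Dl m with ∈-++⁻ (u ∷ branches u v) m
      ... | inj₁ m₁ = All.lookup (side-⊆ e) m₁
      ... | inj₂ m₂ = All.lookup (side-⊆ (adj-sym e)) m₂

    edge-bound : ∀ {u v} → Adj H u v → s * (deg u + deg v) + 2 ≤ k + 2 * s
    edge-bound {u} {v} e = begin
      s * (deg u + deg v) + 2                       ≤⟨ +-monoˡ-≤ 2 (*-monoʳ-≤ s (+-mono-≤ (deg≤ e) (deg≤ (adj-sym e)))) ⟩
      s * (suc Ou + suc Ov) + 2                     ≡⟨ solve 3 (λ s a b → s :* ((con 1 :+ a) :+ (con 1 :+ b)) :+ con 2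
                                                        := ((con 1 :+ a :* s) :+ (con 1 :+ b :* s)) :+ con 2 :* s) refl s Ou Ov ⟩
      (suc (Ou * s) + suc (Ov * s)) + 2 * s         ≤⟨ +-monoˡ-≤ (2 * s) (trees-fit e) ⟩
      k + 2 * s                                     ∎
      where
      open ≤-Reasoning
      Ou Ov : ℕ
      Ou = length (others u v)
      Ov = length (others v u)

    edge-k-bound : ∀ {u v} → Adj H u v → 2 * s + 2 ≤ k
    edge-k-bound {u} {v} e = begin
      2 * s + 2                                     ≡⟨ solve 1 (λ s → con 2 :* s :+ con 2 := (con 1 :+ con 1 :* s) :+ (con 1 :+ con 1 :* s)) refl s ⟩
      suc (1 * s) + suc (1 * s)                     ≤⟨ +-mono-≤ (s≤s (*-monoˡ-≤ s (others-nonempty e))) (s≤s (*-monoˡ-≤ s (others-nonempty (adj-sym e)))) ⟩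
      suc (length (others u v) * s) + suc (length (others v u) * s)  ≤⟨ trees-fit e ⟩
      k                                             ∎
      where open ≤-Reasoning

  degSum degSqSum : ℕ
  degSum = sumOver deg Dl
  degSqSum = sumOver (λ a → deg a * deg a) Dl

  neighbour-degree-sum : sumOver (λ a → sumOver deg (nbrs a)) Dl ≡ degSqSum
  neighbour-degree-sum = begin
    sumOver (λ a → sumOver deg (nbrs a)) Dl                            ≡⟨ sumOver-cong Dl (λ {a} _ → sumOver-select (adj H a) deg Dl) ⟩
    sumOver (λ a → sumOver (λ b → boolToℕ (adj H a b) * deg b) Dl) Dl  ≡⟨ sumOver-swap _ Dl Dl ⟩
    sumOver (λ b → sumOver (λ a → boolToℕ (adj H a b) * deg b) Dl) Dl  ≡⟨ sumOver-cong Dl (λ {b} _ → counted b) ⟩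
    degSqSum                                                           ∎
    where
    open ≡-Reasoning
    counted : ∀ b → sumOver (λ a → boolToℕ (adj H a b) * deg b) Dl ≡ deg b * deg b
    counted b = begin
      sumOver (λ a → boolToℕ (adj H a b) * deg b) Dl   ≡⟨ sumOver-cong Dl (λ {a} _ →
                                                            trans (cong (λ x → boolToℕ x * deg b) (Graph.sym H a b)) (*-comm _ (deg b))) ⟩
      sumOver (λ a → deg b * boolToℕ (adj H b a)) Dl   ≡⟨ sumOver-*ˡ (deg b) (boolToℕ ∘ adj H b) Dl ⟩
      deg b * sumOver (boolToℕ ∘ adj H b) Dl           ≡⟨ cong (deg b *_) (≡.sym (length-select (adj H b) Dl)) ⟩
      deg b * deg b                                    ∎

  module DegreeSums (s′ : ℕ) (room : 2 * suc s′ + 2 ≤ t) where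
    open EdgeTrees s′ room

    -- Summing edge-bound over all ordered edges (a , b).
    edge-sum-bound : 2 * s * degSqSum + 2 * degSum ≤ degSum * (k + 2 * s)
    edge-sum-bound = begin
      2 * s * degSqSum + 2 * degSum
        ≡⟨ solve 4 (λ s q a x → con 2 :* s :* q :+ con 2 :* a := s :* q :+ con 2 :* a :+ s :* q) refl s degSqSum degSum degSum ⟩
      s * degSqSum + 2 * degSum + s * degSqSum
        ≡⟨ ≡.sym (cong (λ x → s * degSqSum + 2 * degSum + s * x) neighbour-degree-sum) ⟩
      s * degSqSum + 2 * degSum + s * sumOver (λ a → sumOver deg (nbrs a)) Dl
        ≡⟨ ≡.sym expand ⟩
      sumOver (λ a → sumOver (λ b → s * (deg a + deg b) + 2) (nbrs a)) Dl
        ≤⟨ sumOver-mono Dl (λ {a} _ → sumOver-mono (nbrs a) (λ mb → edge-bound (∈-nbrs⁻ mb))) ⟩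
      sumOver (λ a → sumOver (λ _ → k + 2 * s) (nbrs a)) Dl
        ≡⟨ sumOver-cong Dl (λ {a} _ → sumOver-const (k + 2 * s) (nbrs a)) ⟩
      sumOver (λ a → deg a * (k + 2 * s)) Dl
        ≡⟨ sumOver-*ʳ (k + 2 * s) deg Dl ⟩
      degSum * (k + 2 * s) ∎
      where
      open ≤-Reasoning
      inner : ∀ a → sumOver (λ b → s * (deg a + deg b) + 2) (nbrs a) ≡ s * (deg a * deg a) + 2 * deg a + s * sumOver deg (nbrs a)
      inner a = begin-equality
        sumOver (λ b → s * (deg a + deg b) + 2) (nbrs a)
          ≡⟨ sumOver-cong (nbrs a) (λ {b} _ → solve 3 (λ s d x → s :* (d :+ x) :+ con 2 := (s :* d :+ con 2) :+ s :* x) refl s (deg a) (deg b)) ⟩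
        sumOver (λ b → (s * deg a + 2) + s * deg b) (nbrs a)
          ≡⟨ sumOver-+ (λ _ → s * deg a + 2) (λ b → s * deg b) (nbrs a) ⟩
        sumOver (λ _ → s * deg a + 2) (nbrs a) + sumOver (λ b → s * deg b) (nbrs a)
          ≡⟨ cong₂ _+_ (sumOver-const (s * deg a + 2) (nbrs a)) (sumOver-*ˡ s deg (nbrs a)) ⟩
        deg a * (s * deg a + 2) + s * sumOver deg (nbrs a)
          ≡⟨ solve 3 (λ s d x → d :* (s :* d :+ con 2) :+ s :* x := s :* (d :* d) :+ con 2 :* d :+ s :* x) refl s (deg a) (sumOver deg (nbrs a)) ⟩
        s * (deg a * deg a) + 2 * deg a + s * sumOver deg (nbrs a) ∎
      expand : sumOver (λ a → sumOver (λ b → s * (deg a + deg b) + 2) (nbrs a)) Dl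
             ≡ s * degSqSum + 2 * degSum + s * sumOver (λ a → sumOver deg (nbrs a)) Dl
      expand = begin-equality
        sumOver (λ a → sumOver (λ b → s * (deg a + deg b) + 2) (nbrs a)) Dl
          ≡⟨ sumOver-cong Dl (λ {a} _ → inner a) ⟩
        sumOver (λ a → s * (deg a * deg a) + 2 * deg a + s * sumOver deg (nbrs a)) Dl
          ≡⟨ sumOver-+ _ (λ a → s * sumOver deg (nbrs a)) Dl ⟩
        sumOver (λ a → s * (deg a * deg a) + 2 * deg a) Dl + sumOver (λ a → s * sumOver deg (nbrs a)) Dl
          ≡⟨ cong₂ _+_ (trans (sumOver-+ _ _ Dl) (cong₂ _+_ (sumOver-*ˡ s (λ a → deg a * deg a) Dl) (sumOver-*ˡ 2 deg Dl)))
                       (sumOver-*ˡ s (λ a → sumOver deg (nbrs a)) Dl) ⟩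
        s * degSqSum + 2 * degSum + s * sumOver (λ a → sumOver deg (nbrs a)) Dl ∎

    -- A positive degree sum exhibits an edge, so the trees of edge-k-bound exist.
    private
      some-edge : ∀ as → 1 ≤ sumOver deg as → ∃ λ a → ∃ λ b → Adj H a b
      some-edge (a ∷ as) pos with nbrs a in eq
      ... | b ∷ _ = a , b , ∈-nbrs⁻ (subst (b ∈ₗ_) (≡.sym eq) (here refl))
      ... | [] = some-edge as pos

    moore-bound : (2 * s + 2) * degSum ≤ 2 * (k * k)
    moore-bound with degSum ≟ 0
    ... | yes A≡0 = ≤-trans (≤-reflexive (trans (cong ((2 * s + 2) *_) A≡0) (*-zeroʳ (2 * s + 2)))) z≤n
    ... | no A≢0 = moore-arithmetic s′ degSum k (edge-k-bound (proj₂ (proj₂ (some-edge Dl A≥1))))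
                     (cancel-degree-sum s degSum degSqSum k A≥1 edge-sum-bound (cauchy-schwarz deg Dl))
      where
      A≥1 : 1 ≤ degSum
      A≥1 = n≢0⇒n>0 A≢0

module Representative {n} (G : Graph n) (D : Subset n) (dom : Dominating G D) where

  open Walks G

  F : Fin n → Fin n
  F v with v ∈? D
  ... | yes _ = v
  ... | no _ with dom v
  ...   | inj₁ _ = v
  ...   | inj₂ (w , _ , _) = w

  F-spec : ∀ v → (v ∈ D × F v ≡ v) ⊎ (v ∉ D × Adj G v (F v) × F v ∈ D)
  F-spec v with v ∈? D
  ... | yes v∈D = inj₁ (v∈D , refl)
  ... | no v∉D with dom v
  ...   | inj₁ v∈D = ⊥-elim (v∉D v∈D)
  ...   | inj₂ (w , w∈D , v~w) = inj₂ (v∉D , v~w , w∈D)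

  F∈D : ∀ v → F v ∈ D
  F∈D v with F-spec v
  ... | inj₁ (v∈D , Fv≡v) = subst (_∈ D) (≡.sym Fv≡v) v∈D
  ... | inj₂ (_ , _ , Fv∈D) = Fv∈D

  F-fixes-D : ∀ {v} → v ∈ D → F v ≡ v
  F-fixes-D {v} v∈D with F-spec v
  ... | inj₁ (_ , Fv≡v) = Fv≡v
  ... | inj₂ (v∉D , _ , _) = ⊥-elim (v∉D v∈D)

  F-idem : ∀ v → F (F v) ≡ F v
  F-idem v = F-fixes-D (F∈D v)

  F-moves : ∀ {v} → v ∉ D → v ≢ F v
  F-moves {v} v∉D v≡Fv = v∉D (subst (_∈ D) (≡.sym v≡Fv) (F∈D v))

  ∈D-≢ : ∀ {x y} → x ∈ D → y ∉ D → x ≢ y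
  ∈D-≢ x∈D y∉D refl = y∉D x∈D

  Dl : List (Fin n)
  Dl = filter (_∈? D) (allFin n)

  ∈-Dl⁺ : ∀ {x} → x ∈ D → x ∈ₗ Dl
  ∈-Dl⁺ {x} = ∈-filter⁺ (_∈? D) (∈-allFin x)

  Dl! : Unique Dl
  Dl! = Unique.filter⁺ (_∈? D) (Unique.allFin⁺ n)

  length-Dl : length Dl ≤ ∣ D ∣
  length-Dl = unique-⊆-subset Dl D Dl! (All.tabulate (proj₂ ∘ ∈-filter⁻ (_∈? D) {xs = allFin n}))

  CrossEdge : Fin n → Fin n → Set
  CrossEdge a b = a ≢ b × ∃ λ x → ∃ λ y → Adj G x y × F x ≡ a × F y ≡ b

  cross-edge? : ∀ a b → Dec (CrossEdge a b)
  cross-edge? a b = ¬? (a ≟ᶠ b) ×-dec any? (λ x → any? (λ y → (adj G x y ≟ᵇ true) ×-dec ((F x ≟ᶠ a) ×-dec (F y ≟ᶠ b))))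

  cross-edge-sym : ∀ {a b} → CrossEdge a b → CrossEdge b a
  cross-edge-sym (a≢b , x , y , x~y , Fx , Fy) = a≢b ∘ ≡.sym , y , x , adj-sym x~y , Fy , Fx

  cross-adj : Fin n → Fin n → Bool
  cross-adj a b = ⌊ cross-edge? a b ⌋

  H : Graph n
  H = record { adj = cross-adj ; sym = symmetric ; irrefl = irreflexive }
    where
    symmetric : ∀ a b → cross-adj a b ≡ cross-adj b a
    symmetric a b with cross-edge? a b | cross-edge? b a
    ... | yes _ | yes _ = refl
    ... | no _ | no _ = refl
    ... | yes ab | no ¬ba = ⊥-elim (¬ba (cross-edge-sym ab))
    ... | no ¬ab | yes ba = ⊥-elim (¬ab (cross-edge-sym ba))
    irreflexive : ∀ a → cross-adj a a ≡ false
    irreflexive a with cross-edge? a a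
    ... | yes (a≢a , _) = ⊥-elim (a≢a refl)
    ... | no _ = refl

  to-H : ∀ {a b} → CrossEdge a b → Adj H a b
  to-H {a} {b} ab with cross-edge? a b
  ... | yes _ = refl
  ... | no ¬ab = ⊥-elim (¬ab ab)

  from-H : ∀ {a b} → Adj H a b → CrossEdge a b
  from-H {a} {b} a~b with cross-edge? a b
  ... | yes ab = ab

  H-in-D : ∀ {a b} → Adj H a b → a ∈ D
  H-in-D a~b with from-H a~b
  ... | _ , x , _ , _ , refl , _ = F∈D x

  module Girth≥7 (g : ℕ) (girth : ∀ c → IsCycle G c → g ≤ length c) (g≥7 : 7 ≤ g) where

    no-short-cycle : ∀ c → IsCycle G c → length c ≤ 6 → ⊥
    no-short-cycle c cyc ≤6 = <⇒≱ (≤-trans (s≤s ≤6) g≥7) (girth c cyc)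

    -- An edge inside a class has the representative as an end (else x y F x is a triangle).
    inner-edge : ∀ {x y} → Adj G x y → F x ≡ F y → x ≡ F x ⊎ y ≡ F y
    inner-edge {x} {y} x~y Fx≡Fy with F-spec x | F-spec y
    ... | inj₁ (_ , Fx≡x) | _ = inj₁ (≡.sym Fx≡x)
    ... | inj₂ _ | inj₁ (_ , Fy≡y) = inj₂ (≡.sym Fy≡y)
    ... | inj₂ (x∉D , x~Fx , _) | inj₂ (y∉D , y~Fy , _) =
      ⊥-elim (no-short-cycle (x ∷ y ∷ F x ∷ []) triangle (s≤s (s≤s (s≤s z≤n))))
      where
      triangle : IsCycle G (x ∷ y ∷ F x ∷ [])
      triangle = s≤s (s≤s (s≤s z≤n))
               , ((adj-≢ x~y ∷ F-moves x∉D ∷ []) ∷ ((F-moves y∉D ∘ (λ y≡Fx → trans y≡Fx Fx≡Fy)) ∷ []) ∷ [] ∷ [])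
               , x~y , subst (Adj G y) (≡.sym Fx≡Fy) y~Fy , adj-sym x~Fx , tt

    record ClassPath (p q : Fin n) : Set where
      field
        rest     : List (Fin n)
        chain    : Chain G p rest
        ends     : endpoint p rest ≡ q
        inClass  : All (λ y → F y ≡ F p) (p ∷ rest)
        distinct : Unique (p ∷ rest)
        short    : length rest ≤ 2
        moves    : p ≢ q → 1 ≤ length rest

    class-path : ∀ p q → F p ≡ F q → ClassPath p q
    class-path p q Fp≡Fq with p ≟ᶠ q
    ... | yes refl = record { rest = [] ; chain = tt ; ends = refl ; inClass = refl ∷ [] ; distinct = [] ∷ []
                            ; short = z≤n ; moves = λ p≢p → ⊥-elim (p≢p refl) }
    ... | no p≢q with F-spec p | F-spec q
    ...   | inj₁ (_ , Fp≡p) | inj₁ (_ , Fq≡q) = ⊥-elim (p≢q (trans (≡.sym Fp≡p) (trans Fp≡Fq Fq≡q)))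
    ...   | inj₁ (_ , Fp≡p) | inj₂ (_ , q~Fq , _) = record
            { rest = [ q ] ; chain = adj-sym (subst (Adj G q) (trans (≡.sym Fp≡Fq) Fp≡p) q~Fq) , tt ; ends = refl
            ; inClass = refl ∷ ≡.sym Fp≡Fq ∷ [] ; distinct = (p≢q ∷ []) ∷ [] ∷ [] ; short = s≤s z≤n ; moves = λ _ → s≤s z≤n }
    ...   | inj₂ (_ , p~Fp , _) | inj₁ (_ , Fq≡q) = record
            { rest = [ q ] ; chain = subst (Adj G p) (trans Fp≡Fq Fq≡q) p~Fp , tt ; ends = refl
            ; inClass = refl ∷ ≡.sym Fp≡Fq ∷ [] ; distinct = (p≢q ∷ []) ∷ [] ∷ [] ; short = s≤s z≤n ; moves = λ _ → s≤s z≤n }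
    ...   | inj₂ (p∉D , p~Fp , Fp∈D) | inj₂ (q∉D , q~Fq , _) = record
            { rest = F p ∷ [ q ] ; chain = p~Fp , adj-sym (subst (Adj G q) (≡.sym Fp≡Fq) q~Fq) , tt ; ends = refl
            ; inClass = refl ∷ F-idem p ∷ ≡.sym Fp≡Fq ∷ []
            ; distinct = (F-moves p∉D ∷ p≢q ∷ []) ∷ (∈D-≢ Fp∈D q∉D ∷ []) ∷ [] ∷ []
            ; short = s≤s (s≤s z≤n) ; moves = λ _ → s≤s z≤n }

    -- Two different edges x₁y₁, x₂y₂ between the same two distinct classes: the class
    -- paths x₂ ⇝ x₁ and y₁ ⇝ y₂ together with both edges form a cycle on at most 6 vertices.
    module CrossCycle {x₁ y₁ x₂ y₂} (e₁ : Adj G x₁ y₁) (e₂ : Adj G x₂ y₂) (Fx : F x₁ ≡ F x₂) (Fy : F y₁ ≡ F y₂)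
                      (apart : F x₁ ≢ F y₁) (different : x₂ ≢ x₁ ⊎ y₁ ≢ y₂) where
      private
        module P₁ = ClassPath (class-path x₂ x₁ (≡.sym Fx))
        module P₂ = ClassPath (class-path y₁ y₂ Fy)

      vertices : List (Fin n)
      vertices = x₂ ∷ (P₁.rest ++ y₁ ∷ P₂.rest)

      closed : Chain G x₂ ((P₁.rest ++ y₁ ∷ P₂.rest) ++ [ x₂ ])
      closed = subst (Chain G x₂) (≡.sym (++-assoc P₁.rest (y₁ ∷ P₂.rest) [ x₂ ]))
                 (chain-++ x₂ P₁.rest P₁.chain (subst (λ z → Adj G z y₁) (≡.sym P₁.ends) e₁)
                   (chain-++ y₁ P₂.rest P₂.chain (subst (λ z → Adj G z x₂) (≡.sym P₂.ends) (adj-sym e₂)) tt))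

      length-vertices : length vertices ≡ suc (suc (length P₁.rest + length P₂.rest))
      length-vertices = cong suc (trans (length-++ P₁.rest) (+-suc (length P₁.rest) (length P₂.rest)))

      cycle : IsCycle G vertices
      cycle = subst (3 ≤_) (≡.sym length-vertices) (s≤s (s≤s moved))
            , Unique.++⁺ P₁.distinct P₂.distinct classes-apart
            , closed
        where
        moved : 1 ≤ length P₁.rest + length P₂.rest
        moved = [ (λ d → ≤-trans (P₁.moves d) (m≤m+n _ _)) , (λ d → ≤-trans (P₂.moves d) (m≤n+m _ _)) ]′ different
        classes-apart : Disjoint (x₂ ∷ P₁.rest) (y₁ ∷ P₂.rest)
        classes-apart (m₁ , m₂) = apart (trans Fx (trans (≡.sym (All.lookup P₁.inClass m₁)) (All.lookup P₂.inClass m₂)))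

      short : length vertices ≤ 6
      short = ≤-trans (≤-reflexive length-vertices) (s≤s (s≤s (+-mono-≤ P₁.short P₂.short)))

    unique-cross-edge : ∀ {x₁ y₁ x₂ y₂} → Adj G x₁ y₁ → Adj G x₂ y₂ → F x₁ ≡ F x₂ → F y₁ ≡ F y₂ →
                        F x₁ ≢ F y₁ → x₁ ≡ x₂ × y₁ ≡ y₂
    unique-cross-edge {x₁} {y₁} {x₂} {y₂} e₁ e₂ Fx Fy apart with x₁ ≟ᶠ x₂ | y₁ ≟ᶠ y₂
    ... | yes x≡ | yes y≡ = x≡ , y≡
    ... | no x≢ | _ = ⊥-elim (no-short-cycle _ C.cycle C.short)
      where module C = CrossCycle e₁ e₂ Fx Fy apart (inj₁ (x≢ ∘ ≡.sym))
    ... | yes _ | no y≢ = ⊥-elim (no-short-cycle _ C.cycle C.short)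
      where module C = CrossCycle e₁ e₂ Fx Fy apart (inj₂ y≢)

    private
      module WH = Walks H

    -- A duplicate-free H-walk a₀ a₁ … a_m lifts to a G-path from any p in class a₀ to any
    -- q in class a_m running through the classes a₀, …, a_m, with between m and 3m + 2 steps:
    -- class paths of at most two steps are linked by the edges realising a_i ~ a_{i+1}.
    record Lift (p q a₀ : Fin n) (as : List (Fin n)) : Set where
      field
        rest      : List (Fin n)
        chain     : Chain G p rest
        ends      : endpoint p rest ≡ q
        inClasses : All (λ y → F y ∈ₗ (a₀ ∷ as)) (p ∷ rest)
        distinct  : Unique (p ∷ rest)
        short     : length rest ≤ 3 * length as + 2
        long      : length as ≤ length rest

    lift : ∀ a₀ as p q → Chain H a₀ as → Unique (a₀ ∷ as) → F p ≡ a₀ → F q ≡ WH.endpoint a₀ as → Lift p q a₀ as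
    lift a₀ [] p q _ _ Fp Fq = record
      { rest = P.rest ; chain = P.chain ; ends = P.ends ; inClasses = All.map (λ Fy → here (trans Fy Fp)) P.inClass
      ; distinct = P.distinct ; short = P.short ; long = z≤n }
      where module P = ClassPath (class-path p q (trans Fp (≡.sym Fq)))
    lift a₀ (a₁ ∷ as) p q (a₀~a₁ , walk) (a₀∉ ∷ as!) Fp Fq with from-H a₀~a₁
    ... | _ , x , y , x~y , Fx , Fy = record
      { rest = P.rest ++ y ∷ R.rest
      ; chain = chain-++ p P.rest P.chain (subst (λ z → Adj G z y) (≡.sym P.ends) x~y) R.chain
      ; ends = trans (endpoint-++ p P.rest) R.ends
      ; inClasses = All-++⁺ (All.map (λ Fz → here (trans Fz Fp)) P.inClass) (All.map there R.inClasses)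
      ; distinct = Unique.++⁺ P.distinct R.distinct apart
      ; short = ≤-trans (≤-reflexive (length-++ P.rest)) (≤-trans (+-mono-≤ P.short (s≤s R.short))
                  (≤-reflexive (solve 1 (λ m → con 2 :+ (con 1 :+ (con 3 :* m :+ con 2)) := con 3 :* (con 1 :+ m) :+ con 2) refl (length as))))
      ; long = ≤-trans (s≤s R.long) (≤-trans (m≤n+m _ (length P.rest)) (≤-reflexive (≡.sym (length-++ P.rest))))
      }
      where
      module P = ClassPath (class-path p x (trans Fp (≡.sym Fx)))
      module R = Lift (lift a₁ as y q walk as! Fy Fq)
      apart : Disjoint (p ∷ P.rest) (y ∷ R.rest)
      apart (m₁ , m₂) = Unique.Unique[x∷xs]⇒x∉xs (a₀∉ ∷ as!) (subst (_∈ₗ (a₁ ∷ as)) (trans (All.lookup P.inClass m₁) Fp) (All.lookup R.inClasses m₂))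

    lift-cycle : ∀ c → IsCycle H c → ∃ λ c′ → IsCycle G c′ × length c′ ≤ 3 * length c
    lift-cycle (a₀ ∷ as) (three≤ , distinct , closed) with WH.chain-++⁻ a₀ as closed
    ... | walk , last~a₀ , _ with from-H last~a₀
    ...   | _ , x , y , x~y , Fx , Fy = y ∷ R.rest , cycle , size
      where
      module R = Lift (lift a₀ as y x walk distinct Fy Fx)
      cycle : IsCycle G (y ∷ R.rest)
      cycle = ≤-trans three≤ (s≤s R.long) , R.distinct , chain-++ y R.rest R.chain (subst (λ z → Adj G z y) (≡.sym R.ends) x~y) tt
      size : suc (length R.rest) ≤ 3 * suc (length as)
      size = ≤-trans (s≤s R.short) (≤-reflexive (solve 1 (λ m → con 1 :+ (con 3 :* m :+ con 2) := con 3 :* (con 1 :+ m)) refl (length as)))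

    H-girth : ∀ c → IsCycle H c → g / 3 ≤ length c
    H-girth c cyc with lift-cycle c cyc
    ... | c′ , cyc′ , c′≤ = *-cancelʳ-≤ (g / 3) (length c) 3
          (≤-trans (m/n*n≤m g 3) (≤-trans (girth c′ cyc′) (≤-trans c′≤ (≤-reflexive (*-comm 3 (length c))))))

    module MinDegree≥2 (deg≥2 : ∀ v → 2 ≤ degree G v) where

      exit : Fin n → Fin n
      exit z = proj₁ (another-neighbour (deg≥2 z) (F z))

      exit-adj : ∀ z → Adj G z (exit z)
      exit-adj z = proj₁ (proj₂ (another-neighbour (deg≥2 z) (F z)))

      exit-leaves : ∀ {z} → z ∉ D → F z ≢ F (exit z)
      exit-leaves {z} z∉D Fz≡Fw =
        [ F-moves z∉D , (λ w≡Fw → proj₂ (proj₂ (another-neighbour (deg≥2 z) (F z))) (trans w≡Fw (≡.sym Fz≡Fw))) ]′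
          (inner-edge (exit-adj z) Fz≡Fw)

      -- Every vertex is determined by a pair of elements of D: v ∈ D by (v , v), and v ∉ D
      -- by its class together with the class of a neighbour outside it (unique-cross-edge).
      private
        code′ : ∀ v → Dec (v ∈ D) → Fin n × Fin n
        code′ v (yes _) = v , v
        code′ v (no _) = F v , F (exit v)

        code′-injective : ∀ v₁ v₂ d₁ d₂ → code′ v₁ d₁ ≡ code′ v₂ d₂ → v₁ ≡ v₂
        code′-injective v₁ v₂ (yes _) (yes _) eq = cong proj₁ eq
        code′-injective v₁ v₂ (yes _) (no v₂∉D) eq = ⊥-elim (exit-leaves v₂∉D (trans (≡.sym (cong proj₁ eq)) (cong proj₂ eq)))
        code′-injective v₁ v₂ (no v₁∉D) (yes _) eq = ⊥-elim (exit-leaves v₁∉D (trans (cong proj₁ eq) (≡.sym (cong proj₂ eq))))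
        code′-injective v₁ v₂ (no v₁∉D) (no _) eq =
          proj₁ (unique-cross-edge (exit-adj v₁) (exit-adj v₂) (cong proj₁ eq) (cong proj₂ eq) (exit-leaves v₁∉D))

        code′-in-D : ∀ v d → code′ v d ∈ₗ pairs (λ _ → Dl) Dl
        code′-in-D v (yes v∈D) = ∈-pairs⁺ (λ _ → Dl) (∈-Dl⁺ v∈D) (∈-Dl⁺ v∈D)
        code′-in-D v (no _) = ∈-pairs⁺ (λ _ → Dl) (∈-Dl⁺ (F∈D v)) (∈-Dl⁺ (F∈D (exit v)))

      code : Fin n → Fin n × Fin n
      code v = code′ v (v ∈? D)

      vertex-bound : n ≤ length Dl * length Dl
      vertex-bound = begin
        n                                   ≡⟨ ≡.sym (length-tabulate (λ v → v)) ⟩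
        length (allFin n)                   ≤⟨ injection-length≤ code (Unique.allFin⁺ n)
                                                 (λ {v₁} {v₂} _ _ → code′-injective v₁ v₂ (v₁ ∈? D) (v₂ ∈? D))
                                                 (λ {v} _ → code′-in-D v (v ∈? D)) ⟩
        length (pairs (λ _ → Dl) Dl)        ≡⟨ trans (length-pairs (λ _ → Dl) Dl) (sumOver-const (length Dl) Dl) ⟩
        length Dl * length Dl               ∎
        where open ≤-Reasoning

      -- Each G-neighbour z of c ∈ D yields an H-neighbour b of c, witnessed by an edge xy of G
      -- from class c to class b from which z can be read off.
      record Through (c z : Fin n) : Set where
        field
          b x y   : Fin n
          x~y     : Adj G x y
          Fx      : F x ≡ c
          Fy      : F y ≡ b
          c≢b     : c ≢ b
          recover : (x ≡ z × z ∉ D) ⊎ (x ≡ c × y ≡ z)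

      through : ∀ {c z} → c ∈ D → Adj G c z → Through c z
      through {c} {z} c∈D c~z with F-spec z
      ... | inj₁ (_ , Fz≡z) = record { b = z ; x = c ; y = z ; x~y = c~z ; Fx = F-fixes-D c∈D ; Fy = Fz≡z
                                     ; c≢b = adj-≢ c~z ; recover = inj₂ (refl , refl) }
      ... | inj₂ (z∉D , _ , _) with F z ≟ᶠ c
      ...   | no Fz≢c = record { b = F z ; x = c ; y = z ; x~y = c~z ; Fx = F-fixes-D c∈D ; Fy = refl
                               ; c≢b = Fz≢c ∘ ≡.sym ; recover = inj₂ (refl , refl) }
      ...   | yes Fz≡c = record { b = F (exit z) ; x = z ; y = exit z ; x~y = exit-adj z ; Fx = Fz≡c ; Fy = refl
                                ; c≢b = exit-leaves z∉D ∘ trans Fz≡c ; recover = inj₁ (refl , z∉D) }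

      same-edge : ∀ {c z₁ z₂} (h₁ : Through c z₁) (h₂ : Through c z₂) → Through.b h₁ ≡ Through.b h₂ →
                  Through.x h₁ ≡ Through.x h₂ × Through.y h₁ ≡ Through.y h₂
      same-edge h₁ h₂ b≡ = unique-cross-edge T₁.x~y T₂.x~y (trans T₁.Fx (≡.sym T₂.Fx)) (trans T₁.Fy (trans b≡ (≡.sym T₂.Fy)))
                                             (λ Fx≡Fy → T₁.c≢b (trans (≡.sym T₁.Fx) (trans Fx≡Fy T₁.Fy)))
        where
        module T₁ = Through h₁
        module T₂ = Through h₂

      through-injective : ∀ {c z₁ z₂} → c ∈ D → (h₁ : Through c z₁) (h₂ : Through c z₂) →
                          Through.b h₁ ≡ Through.b h₂ → z₁ ≡ z₂
      through-injective c∈D h₁ h₂ b≡ with same-edge h₁ h₂ b≡ | Through.recover h₁ | Through.recover h₂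
      ... | x≡ , _ | inj₁ (x₁≡z₁ , _) | inj₁ (x₂≡z₂ , _) = trans (≡.sym x₁≡z₁) (trans x≡ x₂≡z₂)
      ... | _ , y≡ | inj₂ (_ , y₁≡z₁) | inj₂ (_ , y₂≡z₂) = trans (≡.sym y₁≡z₁) (trans y≡ y₂≡z₂)
      ... | x≡ , _ | inj₁ (x₁≡z₁ , z₁∉D) | inj₂ (x₂≡c , _) = ⊥-elim (z₁∉D (subst (_∈ D) (≡.sym (trans (≡.sym x₁≡z₁) (trans x≡ x₂≡c))) c∈D))
      ... | x≡ , _ | inj₂ (x₁≡c , _) | inj₁ (x₂≡z₂ , z₂∉D) = ⊥-elim (z₂∉D (subst (_∈ D) (≡.sym (trans (≡.sym x₂≡z₂) (trans (≡.sym x≡) x₁≡c))) c∈D))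

      H-branching : ∀ {p c} → Adj H p c → ∃ λ b → Adj H c b × b ≢ p
      H-branching {p} {c} p~c = avoid (through c∈D c~z₁) (through c∈D c~z₂) z₂≢z₁
        where
        c∈D : c ∈ D
        c∈D = H-in-D (WH.adj-sym p~c)
        first : ∃ λ z → Adj G c z × z ≢ c
        first = another-neighbour (deg≥2 c) c
        z₁ : Fin n
        z₁ = proj₁ first
        c~z₁ : Adj G c z₁
        c~z₁ = proj₁ (proj₂ first)
        second : ∃ λ z → Adj G c z × z ≢ z₁
        second = another-neighbour (deg≥2 c) z₁
        z₂ : Fin n
        z₂ = proj₁ second
        c~z₂ : Adj G c z₂
        c~z₂ = proj₁ (proj₂ second)
        z₂≢z₁ : z₂ ≢ z₁
        z₂≢z₁ = proj₂ (proj₂ second)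
        edge : ∀ {z} (h : Through c z) → Adj H c (Through.b h)
        edge h = let open Through h in to-H (c≢b , x , y , x~y , Fx , Fy)
        avoid : ∀ {z₁ z₂} (h₁ : Through c z₁) (h₂ : Through c z₂) → z₂ ≢ z₁ → ∃ λ b → Adj H c b × b ≢ p
        avoid h₁ h₂ z₂≢z₁ with Through.b h₁ ≟ᶠ p
        ... | no b₁≢p = Through.b h₁ , edge h₁ , b₁≢p
        ... | yes b₁≡p = Through.b h₂ , edge h₂ , λ b₂≡p → z₂≢z₁ (through-injective c∈D h₂ h₁ (trans b₂≡p (≡.sym b₁≡p)))

      G-edges : List (Fin n × Fin n)
      G-edges = pairs neighbours (allFin n)

      H-edges : List (Fin n × Fin n)
      H-edges = pairs (λ a → select (adj H a) Dl) Dl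

      private
        ∈-H-edges : ∀ {a b} → CrossEdge a b → (a , b) ∈ₗ H-edges
        ∈-H-edges ab@(_ , x , y , _ , refl , refl) = ∈-pairs⁺ (λ a → select (adj H a) Dl) (∈-Dl⁺ (F∈D x)) (∈-select⁺ (adj H (F x)) (∈-Dl⁺ (F∈D y)) (to-H ab))

        exit-edge : ∀ {z} → z ∉ D → (F z , F (exit z)) ∈ₗ H-edges
        exit-edge {z} z∉D = ∈-H-edges (exit-leaves z∉D , z , exit z , exit-adj z , refl , refl)

        tail-outside : ∀ {u v} → Adj G u v → F u ≡ F v → v ≡ F v → u ∉ D
        tail-outside {u} {v} u~v Fu≡Fv v≡Fv u∈D = adj-≢ u~v (trans (≡.sym (F-fixes-D u∈D)) (trans Fu≡Fv (≡.sym v≡Fv)))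

        head-outside : ∀ {v} → v ≢ F v → v ∉ D
        head-outside v≢Fv v∈D = v≢Fv (≡.sym (F-fixes-D v∈D))

        -- Label 0 for an edge between classes, 1 (resp. 2) for an edge inside a class ending
        -- (resp. starting) at the representative, recorded through the exit of its other end.
        label′ : ∀ u v → Dec (F u ≡ F v) → Dec (v ≡ F v) → Fin 3 × (Fin n × Fin n)
        label′ u v (no _) _ = zero , F u , F v
        label′ u v (yes _) (yes _) = suc zero , F u , F (exit u)
        label′ u v (yes _) (no _) = suc (suc zero) , F v , F (exit v)

        label′-in : ∀ {u v} → Adj G u v → ∀ d₁ d₂ → label′ u v d₁ d₂ ∈ₗ pairs (λ _ → H-edges) (allFin 3)
        label′-in {u} {v} u~v (no Fu≢Fv) _ = ∈-pairs⁺ (λ _ → H-edges) (∈-allFin _) (∈-H-edges (Fu≢Fv , u , v , u~v , refl , refl))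
        label′-in u~v (yes Fu≡Fv) (yes v≡Fv) = ∈-pairs⁺ (λ _ → H-edges) (∈-allFin _) (exit-edge (tail-outside u~v Fu≡Fv v≡Fv))
        label′-in u~v (yes _) (no v≢Fv) = ∈-pairs⁺ (λ _ → H-edges) (∈-allFin _) (exit-edge (head-outside v≢Fv))

        tail-is-rep : ∀ {u v} → Adj G u v → F u ≡ F v → v ≢ F v → u ≡ F u
        tail-is-rep u~v Fu≡Fv v≢Fv = [ (λ u≡Fu → u≡Fu) , (λ v≡Fv → ⊥-elim (v≢Fv v≡Fv)) ]′ (inner-edge u~v Fu≡Fv)

        label′-injective : ∀ {u₁ v₁ u₂ v₂} → Adj G u₁ v₁ → Adj G u₂ v₂ → ∀ d₁ d₂ d₃ d₄ →
                           label′ u₁ v₁ d₁ d₂ ≡ label′ u₂ v₂ d₃ d₄ → (u₁ , v₁) ≡ (u₂ , v₂)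
        label′-injective e₁ e₂ (no Fu≢Fv) _ (no _) _ eq =
          let u≡ , v≡ = unique-cross-edge e₁ e₂ (cong (proj₁ ∘ proj₂) eq) (cong (proj₂ ∘ proj₂) eq) Fu≢Fv in cong₂ _,_ u≡ v≡
        label′-injective {u₁} {v₁} {u₂} {v₂} e₁ e₂ (yes Fu≡Fv₁) (yes v≡Fv₁) (yes Fu≡Fv₂) (yes v≡Fv₂) eq =
          cong₂ _,_ u≡ (trans v≡Fv₁ (trans (≡.sym Fu≡Fv₁) (trans (cong (proj₁ ∘ proj₂) eq) (trans Fu≡Fv₂ (≡.sym v≡Fv₂)))))
          where
          u≡ : u₁ ≡ u₂
          u≡ = proj₁ (unique-cross-edge (exit-adj u₁) (exit-adj u₂) (cong (proj₁ ∘ proj₂) eq) (cong (proj₂ ∘ proj₂) eq)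
                                        (exit-leaves (tail-outside e₁ Fu≡Fv₁ v≡Fv₁)))
        label′-injective {u₁} {v₁} {u₂} {v₂} e₁ e₂ (yes Fu≡Fv₁) (no v≢Fv₁) (yes Fu≡Fv₂) (no v≢Fv₂) eq =
          cong₂ _,_ (trans (tail-is-rep e₁ Fu≡Fv₁ v≢Fv₁) (trans Fu≡Fv₁ (trans (cong F v≡) (trans (≡.sym Fu≡Fv₂) (≡.sym (tail-is-rep e₂ Fu≡Fv₂ v≢Fv₂))))))
                    v≡
          where
          v≡ : v₁ ≡ v₂
          v≡ = proj₁ (unique-cross-edge (exit-adj v₁) (exit-adj v₂) (cong (proj₁ ∘ proj₂) eq) (cong (proj₂ ∘ proj₂) eq)
                                        (exit-leaves (head-outside v≢Fv₁)))
        label′-injective _ _ (no _) _ (yes _) (yes _) ()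
        label′-injective _ _ (no _) _ (yes _) (no _) ()
        label′-injective _ _ (yes _) (yes _) (no _) _ ()
        label′-injective _ _ (yes _) (no _) (no _) _ ()
        label′-injective _ _ (yes _) (yes _) (yes _) (no _) ()
        label′-injective _ _ (yes _) (no _) (yes _) (yes _) ()

      label : Fin n × Fin n → Fin 3 × (Fin n × Fin n)
      label (u , v) = label′ u v (F u ≟ᶠ F v) (v ≟ᶠ F v)

      G-edges≤3·H-edges : length G-edges ≤ 3 * length H-edges
      G-edges≤3·H-edges = begin
        length G-edges                              ≤⟨ injection-length≤ label
                                                         (pairs-unique neighbours (Unique.allFin⁺ n) (λ u → select-unique (adj G u) (Unique.allFin⁺ n)))
                                                         (λ m₁ m₂ eq → label′-injective (edge m₁) (edge m₂) _ _ _ _ eq)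
                                                         (λ m → label′-in (edge m) _ _) ⟩
        length (pairs (λ _ → H-edges) (allFin 3))   ≡⟨ trans (length-pairs (λ _ → H-edges) (allFin 3)) (sumOver-const (length H-edges) (allFin 3)) ⟩
        3 * length H-edges                          ∎
        where
        open ≤-Reasoning
        edge : ∀ {u v} → (u , v) ∈ₗ G-edges → Adj G u v
        edge {u} m = proj₂ (∈-select⁻ (adj G u) {xs = allFin n} (proj₂ (∈-pairs⁻ neighbours {xs = allFin n} m)))

halve : ∀ x → ∃ λ h → 2 * h ≤ x × x ≤ 2 * h + 1
halve zero = 0 , z≤n , z≤n
halve (suc zero) = 0 , z≤n , s≤s z≤n
halve (suc (suc x)) with halve x
... | h , lo , hi = suc h , subst (_≤ suc (suc x)) (≡.sym (*-suc 2 h)) (s≤s (s≤s lo))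
                          , subst (λ y → suc (suc x) ≤ y + 1) (≡.sym (*-suc 2 h)) (s≤s (s≤s hi))

tree-depth : ∀ t → 4 ≤ t → ∃ λ s′ → 2 * suc s′ + 2 ≤ t × t ∸ 1 ≤ 2 * suc s′ + 2
tree-depth (suc (suc (suc (suc x)))) _ with halve x
... | h , lo , hi = h
  , ≤-trans (≤-reflexive (solve 1 (λ h → con 2 :* (con 1 :+ h) :+ con 2 := con 4 :+ con 2 :* h) refl h)) (+-monoʳ-≤ 4 lo)
  , ≤-trans (+-monoʳ-≤ 3 hi) (≤-reflexive (solve 1 (λ h → con 3 :+ (con 2 :* h :+ con 1) := con 2 :* (con 1 :+ h) :+ con 2) refl h))
tree-depth (suc (suc (suc zero))) (s≤s (s≤s (s≤s ())))
tree-depth (suc (suc zero)) (s≤s (s≤s ()))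
tree-depth (suc zero) (s≤s ())

-- Both bounds hold for every dominating set D of G, not only for a minimum one.
dominating-set-bounds : ∀ {n} (G : Graph n) (g : ℕ) → (∀ c → IsCycle G c → g ≤ length c) → 12 ≤ g →
                        (∀ v → 2 ≤ degree G v) → ∀ D → Dominating G D →
                        n ≤ ∣ D ∣ * ∣ D ∣ × (g / 3 ∸ 1) * edgeCount G ≤ 3 * (∣ D ∣ * ∣ D ∣)
dominating-set-bounds G g girth g≥12 deg≥2 D dom = ≤-trans vertex-bound k²≤ , edge-part
  where
  open Representative G D dom
  open Girth≥7 g girth (≤-trans (s≤s (s≤s (s≤s (s≤s (s≤s (s≤s (s≤s z≤n))))))) g≥12)
  open MinDegree≥2 deg≥2
  module Moore = MooreBound H (g / 3) H-girth Dl Dl! (λ e → ∈-Dl⁺ (H-in-D e)) H-branching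
  k : ℕ
  k = length Dl
  k²≤ : k * k ≤ ∣ D ∣ * ∣ D ∣
  k²≤ = *-mono-≤ length-Dl length-Dl
  t-1 m : ℕ
  t-1 = g / 3 ∸ 1
  m = edgeCount G
  edge-part : t-1 * m ≤ 3 * (∣ D ∣ * ∣ D ∣)
  edge-part with tree-depth (g / 3) (/-monoˡ-≤ 3 g≥12)
  ... | s′ , room , t-1≤ = ≤-trans (*-cancelˡ-≤ 2 (begin
    2 * (t-1 * m)                   ≡⟨ solve 2 (λ c m → con 2 :* (c :* m) := c :* (con 2 :* m)) refl t-1 m ⟩
    t-1 * (2 * m)                   ≡⟨ cong (t-1 *_) (≡.sym (Walks.handshake G)) ⟩
    t-1 * length G-edges            ≤⟨ *-monoʳ-≤ t-1 G-edges≤3·H-edges ⟩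
    t-1 * (3 * length H-edges)      ≡⟨ cong (λ a → t-1 * (3 * a)) (length-pairs _ Dl) ⟩
    t-1 * (3 * Moore.degSum)        ≤⟨ *-monoˡ-≤ (3 * Moore.degSum) t-1≤ ⟩
    c * (3 * Moore.degSum)          ≡⟨ solve 2 (λ c a → c :* (con 3 :* a) := con 3 :* (c :* a)) refl c Moore.degSum ⟩
    3 * (c * Moore.degSum)          ≤⟨ *-monoʳ-≤ 3 Sums.moore-bound ⟩
    3 * (2 * (k * k))               ≡⟨ solve 1 (λ q → con 3 :* (con 2 :* q) := con 2 :* (con 3 :* q)) refl (k * k) ⟩
    2 * (3 * (k * k))               ∎)) (*-monoʳ-≤ 3 k²≤)
    where
    open ≤-Reasoning
    module Sums = Moore.DegreeSums s′ room
    c : ℕ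
    c = 2 * suc s′ + 2

theorem3 : ∀ (n : ℕ) (G : Graph n) (g γ : ℕ) → IsGirth G g → 12 ≤ g → MinDegree G 2 → IsDominationNumber G γ → n ≤ γ * γ × ((g / 3) ∸ 1) * edgeCount G ≤ 3 * (γ * γ)
theorem3 n G g γ (_ , girth) g≥12 (deg≥2 , _) ((D , dom , ∣D∣≡γ) , _) =
  subst (λ k → n ≤ k * k × (g / 3 ∸ 1) * edgeCount G ≤ 3 * (k * k)) ∣D∣≡γ
        (dominating-set-bounds G g girth g≥12 deg≥2 D dom)
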